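{- Let $\sigma$ be a permutation of $\{1,\dots,n\}$ such that $\lambda=\Gamma(P(\sigma))$ has exactly two rows, and suppose the cycle decomposition of $\sigma$ contains exactly $r$ cycles of length $1$ (i.e. $\sigma$ has exactly $r$ fixed points). Then $\lambda_1\ge\lambda_2+r$.
   Context: Permutations are written as sequences $(\sigma_1,\dots,\sigma_n)$ with $\sigma_i$ the image of $i$. $P(\sigma)$ is the Robinson--Schensted--Knuth insertion tableau of $\sigma$ (Schensted row insertion of $\sigma_1,\sigma_2,\dots$ in order), and $\Gamma(P(\sigma))=(\lambda_1,\lambda_2,\dots)$ is its shape, the row lengths in nonincreasing order. -}

module Defs where

open import Data.Nat using (ℕ; zero; suc; _≤_; _<?_)
open import Data.Fin using (Fin; toℕ; _≟_)
open import Data.List using (List; []; _∷_; map; length; allFin; filter)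
open import Data.Fin.Permutation using (Permutation′; _⟨$⟩ʳ_)
open import Relation.Nullary using (yes; no)

-- A Young tableau is represented as its list of rows (top row first),
-- each row a list of entries read left to right.
Tableau : Set
Tableau = List (List ℕ)

data Bump : Set where
  none  : Bump
  bumped : ℕ → Bump

record RowResult : Set where
  constructor _,_
  field
    out : Bump
    row : List ℕ

insertRow : ℕ → List ℕ → RowResult
insertRow x [] = none , (x ∷ [])
insertRow x (y ∷ ys) with x <? y
... | yes _ = bumped y , (x ∷ ys)
... | no _ with insertRow x ys
...   | b , ys' = b , (y ∷ ys')

insertT : ℕ → Tableau → Tableau
insertT x [] = (x ∷ []) ∷ []
insertT x (r ∷ rs) with insertRow x r
... | none , r' = r' ∷ rs
... | bumped y , r' = r' ∷ insertT y rs

insertWord : List ℕ → Tableau → Tableau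
insertWord [] t = t
insertWord (x ∷ xs) t = insertWord xs (insertT x t)

-- The word (σ_1, …, σ_n) of a permutation (on {0,…,n-1}; relabelling by +1
-- does not change the relative order, hence not the RSK shape).
word : ∀ {n} → Permutation′ n → List ℕ
word {n} σ = map (λ i → toℕ (σ ⟨$⟩ʳ i)) (allFin n)

P : ∀ {n} → Permutation′ n → Tableau
P σ = insertWord (word σ) []

Γ : Tableau → List ℕ
Γ t = map length t

fixedPoints : ∀ {n} → Permutation′ n → ℕ
fixedPoints {n} σ = length (filter (λ i → (σ ⟨$⟩ʳ i) ≟ i) (allFin n))

-- If P(σ) has two rows then σ avoids 321, since a decreasing subsequence of
-- length three forces a third row under row insertion. In a 321-avoiding
-- permutation the values at the weak excedances (i ≤ σ i) increase, and so do
-- the values at the weak deficiencies (σ i ≤ i): by counting, an inversion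
-- ending at a weak excedance, or starting at a weak deficiency, extends to a
-- 321 pattern. An increasing subsequence of the word is never longer than the
-- first row, and the two sets cover all n positions with the r fixed points
-- counted twice, so λ₁ + λ₂ + r = n + r ≤ 2 λ₁.

module Submission where

open import Defs
open import Data.Nat using (ℕ; zero; suc; _+_; _≤_; _<_; _<?_; _≤?_; _≟_; z≤n; s≤s; s<s⁻¹)
open import Data.Nat.Properties
open import Data.Nat.ListAction using (sum)
open import Data.Bool using (if_then_else_)
open import Data.List using (List; []; _∷_; map; length; filter; allFin)
open import Data.List.Properties using (length-map; length-tabulate; filter-≐)
open import Data.List.Membership.Propositional using (_∈_)
open import Data.List.Membership.Propositional.Properties using (∈-allFin)
open import Data.List.Relation.Unary.Any using (Any; here; there)
open import Data.List.Relation.Unary.All as All using (All; []; _∷_)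
open import Data.List.Relation.Unary.All.Properties using (all-filter)
open import Data.List.Relation.Unary.AllPairs using (AllPairs; []; _∷_)
import Data.List.Relation.Unary.AllPairs.Properties as AllPairs
open import Data.List.Relation.Binary.Sublist.Propositional using (_⊆_; []; _∷_; _∷ʳ_; minimum)
open import Data.List.Relation.Binary.Sublist.Propositional.Properties using (map⁺; filter-⊆)
open import Data.Fin using (Fin; toℕ; zero; suc)
open import Data.Fin.Properties using (toℕ<n; toℕ-injective; any?)
import Data.Fin.Properties as Fin
open import Data.Fin.Permutation using (Permutation′; _⟨$⟩ʳ_; _⟨$⟩ˡ_; inverseˡ)
open import Algebra.Properties.CommutativeMonoid.Sum +-0-commutativeMonoid using (sum-permute) renaming (sum to ∑)
open import Data.Product using (∃; _×_; _,_; proj₂)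
open import Data.Sum using (_⊎_; inj₁; inj₂)
open import Data.Empty using (⊥; ⊥-elim)
open import Function using (_∘_)
open import Relation.Nullary using (Dec; yes; no; does; ¬_)
open import Relation.Nullary.Decidable using (_×-dec_)
open import Relation.Unary using (Pred; Decidable; _≐_)
open import Relation.Unary.Properties using (_∩?_)
open import Relation.Binary using (Rel; Irreflexive; Transitive; tri<; tri≈; tri>)
open import Relation.Binary.PropositionalEquality using (_≡_; _≢_; refl; trans; sym; cong; cong₂; subst₂; module ≡-Reasoning)

data RowInsertion (x : ℕ) : List ℕ → Bump → List ℕ → Set where
  append : RowInsertion x [] none (x ∷ [])
  bump   : ∀ {y ys} → x < y → RowInsertion x (y ∷ ys) (bumped y) (x ∷ ys)
  pass   : ∀ {y ys b ys′} → y ≤ x → RowInsertion x ys b ys′ →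
           RowInsertion x (y ∷ ys) b (y ∷ ys′)

insertRow-sound : ∀ x r →
  RowInsertion x r (RowResult.out (insertRow x r)) (RowResult.row (insertRow x r))
insertRow-sound x [] = append
insertRow-sound x (y ∷ ys) with x <? y
... | yes x<y = bump x<y
... | no x≮y with insertRow x ys | insertRow-sound x ys
...   | _ , _ | ins = pass (≮⇒≥ x≮y) ins

module _ {x : ℕ} where

  ∈-inserted : ∀ {r b r′} → RowInsertion x r b r′ → x ∈ r′
  ∈-inserted append       = here refl
  ∈-inserted (bump _)     = here refl
  ∈-inserted (pass _ ins) = there (∈-inserted ins)

  settled-≤ : ∀ {r r′} → RowInsertion x r none r′ → All (_≤ x) r
  settled-≤ append         = []
  settled-≤ (pass y≤x ins) = y≤x ∷ settled-≤ ins

  settled-keeps : ∀ {r r′ e} → RowInsertion x r none r′ → e ∈ r → e ∈ r′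
  settled-keeps (pass _ ins) (here e≡y) = here e≡y
  settled-keeps (pass _ ins) (there e∈) = there (settled-keeps ins e∈)

  bumped-keeps : ∀ {r z r′ e} → RowInsertion x r (bumped z) r′ → e ∈ r → e ≢ z → e ∈ r′
  bumped-keeps (bump _)     (here refl) e≢z = ⊥-elim (e≢z refl)
  bumped-keeps (bump _)     (there e∈)  _   = there e∈
  bumped-keeps (pass _ ins) (here e≡y)  _   = here e≡y
  bumped-keeps (pass _ ins) (there e∈)  e≢z = there (bumped-keeps ins e∈ e≢z)

  <-bumped : ∀ {r z r′} → RowInsertion x r (bumped z) r′ → x < z
  <-bumped (bump x<z)   = x<z
  <-bumped (pass _ ins) = <-bumped ins

  bumped-≤ : ∀ {r z r′ c} → AllPairs _≤_ r → RowInsertion x r (bumped z) r′ →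
             c ∈ r → x < c → z ≤ c
  bumped-≤ _            (bump _)     (here refl) _   = ≤-refl
  bumped-≤ (y≤ys ∷ _)   (bump _)     (there c∈)  _   = All.lookup y≤ys c∈
  bumped-≤ _            (pass y≤x _) (here refl) x<c = ⊥-elim (<⇒≱ x<c y≤x)
  bumped-≤ (_ ∷ sorted) (pass _ ins) (there c∈)  x<c = bumped-≤ sorted ins c∈ x<c

  lower-bound-inserted : ∀ {r b r′ m} → All (m ≤_) r → m ≤ x → RowInsertion x r b r′ →
                         All (m ≤_) r′
  lower-bound-inserted _            m≤x append       = m≤x ∷ []
  lower-bound-inserted (_ ∷ m≤ys)   m≤x (bump _)     = m≤x ∷ m≤ys
  lower-bound-inserted (m≤y ∷ m≤ys) m≤x (pass _ ins) = m≤y ∷ lower-bound-inserted m≤ys m≤x ins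

  sorted-inserted : ∀ {r b r′} → AllPairs _≤_ r → RowInsertion x r b r′ → AllPairs _≤_ r′
  sorted-inserted _               append         = [] ∷ []
  sorted-inserted (y≤ys ∷ sorted) (bump x<y)     = All.map (≤-trans (<⇒≤ x<y)) y≤ys ∷ sorted
  sorted-inserted (y≤ys ∷ sorted) (pass y≤x ins) =
    lower-bound-inserted y≤ys y≤x ins ∷ sorted-inserted sorted ins

  length-settled : ∀ {r r′} → RowInsertion x r none r′ → length r′ ≡ suc (length r)
  length-settled append       = refl
  length-settled (pass _ ins) = cong suc (length-settled ins)

  length-bumped : ∀ {r z r′} → RowInsertion x r (bumped z) r′ → length r′ ≡ length r
  length-bumped (bump _)     = refl
  length-bumped (pass _ ins) = cong suc (length-bumped ins)

data InsertStep (x : ℕ) (r : List ℕ) (rs : Tableau) : Tableau → Set where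
  settles : ∀ {r′}   → RowInsertion x r none r′ → InsertStep x r rs (r′ ∷ rs)
  bumps   : ∀ {z r′} → RowInsertion x r (bumped z) r′ → InsertStep x r rs (r′ ∷ insertT z rs)

insertT-step : ∀ x r rs → InsertStep x r rs (insertT x (r ∷ rs))
insertT-step x r rs with insertRow x r | insertRow-sound x r
... | none     , _ | ins = settles ins
... | bumped _ , _ | ins = bumps ins

firstRow : Tableau → List ℕ
firstRow []      = []
firstRow (r ∷ _) = r

secondRow : Tableau → List ℕ
secondRow []       = []
secondRow (_ ∷ rs) = firstRow rs

firstRow-insertT : ∀ x t → ∃ λ b → RowInsertion x (firstRow t) b (firstRow (insertT x t))
firstRow-insertT x []       = none , append
firstRow-insertT x (r ∷ rs) with insertT x (r ∷ rs) | insertT-step x r rs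
... | _ | settles ins = none , ins
... | _ | bumps ins   = bumped _ , ins

∈-firstRow-insertT : ∀ x t → x ∈ firstRow (insertT x t)
∈-firstRow-insertT x t = ∈-inserted (proj₂ (firstRow-insertT x t))

firstRow-sorted : ∀ x t → AllPairs _≤_ (firstRow t) → AllPairs _≤_ (firstRow (insertT x t))
firstRow-sorted x t sorted = sorted-inserted sorted (proj₂ (firstRow-insertT x t))

length-insertT : ∀ x t → length t ≤ length (insertT x t)
length-insertT x []       = z≤n
length-insertT x (r ∷ rs) with insertT x (r ∷ rs) | insertT-step x r rs
... | _ | settles _   = ≤-refl
... | _ | bumps {z} _ = s≤s (length-insertT z rs)

insertT-nonempty : ∀ x t → 1 ≤ length (insertT x t)
insertT-nonempty x []       = ≤-refl
insertT-nonempty x (r ∷ rs) = ≤-trans (s≤s z≤n) (length-insertT x (r ∷ rs))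

length-insertWord : ∀ w t → length t ≤ length (insertWord w t)
length-insertWord []      t = ≤-refl
length-insertWord (x ∷ w) t = ≤-trans (length-insertT x t) (length-insertWord w (insertT x t))

sum-Γ-insertT : ∀ x t → sum (Γ (insertT x t)) ≡ suc (sum (Γ t))
sum-Γ-insertT x []       = refl
sum-Γ-insertT x (r ∷ rs) with insertT x (r ∷ rs) | insertT-step x r rs
... | _ | settles ins = cong (_+ sum (Γ rs)) (length-settled ins)
... | _ | bumps {z} ins =
  trans (cong₂ _+_ (length-bumped ins) (sum-Γ-insertT z rs)) (+-suc (length r) (sum (Γ rs)))

sum-Γ-insertWord : ∀ w t → sum (Γ (insertWord w t)) ≡ length w + sum (Γ t)
sum-Γ-insertWord []      t = refl
sum-Γ-insertWord (x ∷ w) t = trans (sum-Γ-insertWord w (insertT x t))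
  (trans (cong (length w +_) (sum-Γ-insertT x t)) (+-suc (length w) (sum (Γ t))))

countBelow : ℕ → List ℕ → ℕ
countBelow m []       = 0
countBelow m (y ∷ ys) with y <? m
... | yes _ = suc (countBelow m ys)
... | no _  = countBelow m ys

countBelow≤length : ∀ m r → countBelow m r ≤ length r
countBelow≤length m []       = z≤n
countBelow≤length m (y ∷ ys) with y <? m
... | yes _ = s≤s (countBelow≤length m ys)
... | no _  = m≤n⇒m≤1+n (countBelow≤length m ys)

countBelow-mono : ∀ {m m′} → m ≤ m′ → ∀ r → countBelow m r ≤ countBelow m′ r
countBelow-mono m≤m′ []       = z≤n
countBelow-mono {m} {m′} m≤m′ (y ∷ ys) with y <? m | y <? m′
... | yes _   | yes _    = s≤s (countBelow-mono m≤m′ ys)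
... | yes y<m | no y≮m′  = ⊥-elim (y≮m′ (<-≤-trans y<m m≤m′))
... | no _    | yes _    = m≤n⇒m≤1+n (countBelow-mono m≤m′ ys)
... | no _    | no _     = countBelow-mono m≤m′ ys

module _ {x : ℕ} where

  countBelow-inserted : ∀ m {r b r′} → RowInsertion x r b r′ → countBelow m r ≤ countBelow m r′
  countBelow-inserted m append = z≤n
  countBelow-inserted m (bump {y} x<y) with y <? m | x <? m
  ... | yes _   | yes _  = ≤-refl
  ... | yes y<m | no x≮m = ⊥-elim (x≮m (<-trans x<y y<m))
  ... | no _    | yes _  = n≤1+n _
  ... | no _    | no _   = ≤-refl
  countBelow-inserted m (pass {y} _ ins) with y <? m
  ... | yes _ = s≤s (countBelow-inserted m ins)
  ... | no _  = countBelow-inserted m ins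

  countBelow-suc-inserted : ∀ {r b r′} → RowInsertion x r b r′ →
                            suc (countBelow x r) ≤ countBelow (suc x) r′
  countBelow-suc-inserted append with x <? suc x
  ... | yes _    = ≤-refl
  ... | no x≮1+x = ⊥-elim (x≮1+x ≤-refl)
  countBelow-suc-inserted (bump {y} {ys} x<y) with y <? x | x <? suc x
  ... | yes y<x | _        = ⊥-elim (<-asym y<x x<y)
  ... | no _    | yes _    = s≤s (countBelow-mono (n≤1+n x) ys)
  ... | no _    | no x≮1+x = ⊥-elim (x≮1+x ≤-refl)
  countBelow-suc-inserted (pass {y} {ys} y≤x ins) with y <? x | y <? suc x
  ... | yes _ | yes _    = s≤s (countBelow-suc-inserted ins)
  ... | no _  | yes _    = ≤-trans (n≤1+n _) (s≤s (countBelow-suc-inserted ins))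
  ... | _     | no y≮1+x = ⊥-elim (y≮1+x (s≤s y≤x))

-- k entries of the subsequence have been read, all below m, and the first row
-- keeps at least k entries below m; reading the next entry x raises k by one
-- and m to x + 1.
firstRow-increasing : ∀ {s w} t k m → s ⊆ w → AllPairs _<_ s → All (m ≤_) s →
                      k ≤ countBelow m (firstRow t) →
                      k + length s ≤ length (firstRow (insertWord w t))
firstRow-increasing t k m [] _ _ k≤ =
  ≤-trans (≤-reflexive (+-identityʳ k)) (≤-trans k≤ (countBelow≤length m (firstRow t)))
firstRow-increasing t k m (y ∷ʳ s⊆w) inc bounds k≤ =
  firstRow-increasing (insertT y t) k m s⊆w inc bounds
    (≤-trans k≤ (countBelow-inserted m (proj₂ (firstRow-insertT y t))))
firstRow-increasing {x ∷ s} t k m (refl ∷ s⊆w) (x<s ∷ inc) (m≤x ∷ _) k≤ =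
  ≤-trans (≤-reflexive (+-suc k (length s)))
    (firstRow-increasing (insertT x t) (suc k) (suc x) s⊆w inc x<s
      (≤-trans (s≤s (≤-trans k≤ (countBelow-mono m≤x (firstRow t))))
               (countBelow-suc-inserted (proj₂ (firstRow-insertT x t)))))

increasing⇒≤firstRow : ∀ {s w} → s ⊆ w → AllPairs _<_ s → length s ≤ length (firstRow (insertWord w []))
increasing⇒≤firstRow s⊆w inc = firstRow-increasing [] 0 0 s⊆w inc (All.universal (λ _ → z≤n) _) z≤n

ThreeRows : Tableau → Set
ThreeRows t = 3 ≤ length t

_∈ᵀ_ : ℕ → Tableau → Set
a ∈ᵀ t = Any (a ∈_) t

-- b sits in the first row above a larger entry of the second row, so any
-- later c < b bumps through both rows.
Stacked : ℕ → Tableau → Set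
Stacked b t = b ∈ firstRow t × ∃ λ z → z ∈ secondRow t × b < z

threeRows-insertWord : ∀ w t → ThreeRows t → ThreeRows (insertWord w t)
threeRows-insertWord w t three = ≤-trans three (length-insertWord w t)

∈ᵀ-nonempty : ∀ {a t} → a ∈ᵀ t → 1 ≤ length t
∈ᵀ-nonempty (here _)  = s≤s z≤n
∈ᵀ-nonempty (there _) = s≤s z≤n

inserted-∈ᵀ : ∀ x t → x ∈ᵀ insertT x t
inserted-∈ᵀ x []       = here (here refl)
inserted-∈ᵀ x (r ∷ rs) with insertT x (r ∷ rs) | insertT-step x r rs
... | _ | settles ins = here (∈-inserted ins)
... | _ | bumps ins   = here (∈-inserted ins)

∈ᵀ-insertT : ∀ {a} x t → a ∈ᵀ t → a ∈ᵀ insertT x t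
∈ᵀ-insertT {a} x (r ∷ rs) a∈t with insertT x (r ∷ rs) | insertT-step x r rs | a∈t
... | _ | settles ins   | here a∈r   = here (settled-keeps ins a∈r)
... | _ | settles _     | there a∈rs = there a∈rs
... | _ | bumps {z} ins | there a∈rs = there (∈ᵀ-insertT z rs a∈rs)
... | _ | bumps {z} ins | here a∈r with a ≟ z
...   | yes refl = there (inserted-∈ᵀ z rs)
...   | no a≢z   = here (bumped-keeps ins a∈r a≢z)

stacked-inserted : ∀ {a} b t → b < a → a ∈ᵀ t → ThreeRows (insertT b t) ⊎ Stacked b (insertT b t)
stacked-inserted b (r ∷ rs) b<a a∈t with insertT b (r ∷ rs) | insertT-step b r rs | a∈t
... | _ | bumps {z} ins | _                 =
  inj₂ (∈-inserted ins , z , ∈-firstRow-insertT z rs , <-bumped ins)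
... | _ | settles ins   | here a∈r          = ⊥-elim (<⇒≱ b<a (All.lookup (settled-≤ ins) a∈r))
... | _ | settles ins   | there (here a∈r₂) = inj₂ (∈-inserted ins , _ , a∈r₂ , b<a)
... | _ | settles _     | there (there a∈)  = inj₁ (s≤s (s≤s (∈ᵀ-nonempty a∈)))

stacked-insertT : ∀ {b} x t → Stacked b t → ThreeRows (insertT x t) ⊎ Stacked b (insertT x t)
stacked-insertT {b} x (r ∷ r₂ ∷ rs) (b∈r , w , w∈r₂ , b<w)
  with insertT x (r ∷ r₂ ∷ rs) | insertT-step x r (r₂ ∷ rs)
... | _ | settles ins = inj₂ (settled-keeps ins b∈r , w , w∈r₂ , b<w)
... | _ | bumps {z} ins with insertT z (r₂ ∷ rs) | insertT-step z r₂ rs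
...   | _ | bumps {z′} _ = inj₁ (s≤s (s≤s (insertT-nonempty z′ rs)))
...   | _ | settles ins₂ with b ≟ z
...     | yes refl = ⊥-elim (<⇒≱ b<w (All.lookup (settled-≤ ins₂) w∈r₂))
...     | no b≢z   = inj₂ (bumped-keeps ins b∈r b≢z , w , settled-keeps ins₂ w∈r₂ , b<w)

stacked-bumped : ∀ {b c} t → AllPairs _≤_ (firstRow t) → Stacked b t → c < b → ThreeRows (insertT c t)
stacked-bumped {c = c} (r ∷ r₂ ∷ rs) sorted (b∈r , w , w∈r₂ , b<w) c<b
  with insertT c (r ∷ r₂ ∷ rs) | insertT-step c r (r₂ ∷ rs)
... | _ | settles ins = ⊥-elim (<⇒≱ c<b (All.lookup (settled-≤ ins) b∈r))
... | _ | bumps {z} ins with insertT z (r₂ ∷ rs) | insertT-step z r₂ rs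
...   | _ | bumps {z′} _ = s≤s (s≤s (insertT-nonempty z′ rs))
...   | _ | settles ins₂ =
  ⊥-elim (<⇒≱ (≤-<-trans (bumped-≤ sorted ins b∈r c<b) b<w) (All.lookup (settled-≤ ins₂) w∈r₂))

threeRows-after-stacked : ∀ {b c w} t → c < b → (c ∷ []) ⊆ w → AllPairs _≤_ (firstRow t) →
                          ThreeRows t ⊎ Stacked b t → ThreeRows (insertWord w t)
threeRows-after-stacked {w = w} t _ _ _ (inj₁ three) = threeRows-insertWord w t three
threeRows-after-stacked t c<b (y ∷ʳ c⊆w) sorted (inj₂ st) =
  threeRows-after-stacked (insertT y t) c<b c⊆w (firstRow-sorted y t sorted) (stacked-insertT y t st)
threeRows-after-stacked {c = c} {w = c ∷ w} t c<b (refl ∷ _) sorted (inj₂ st) =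
  threeRows-insertWord w (insertT c t) (stacked-bumped t sorted st c<b)

threeRows-after-seen : ∀ {a b c w} t → c < b → b < a → (b ∷ c ∷ []) ⊆ w →
                       AllPairs _≤_ (firstRow t) → a ∈ᵀ t → ThreeRows (insertWord w t)
threeRows-after-seen t c<b b<a (y ∷ʳ bc⊆w) sorted a∈t =
  threeRows-after-seen (insertT y t) c<b b<a bc⊆w (firstRow-sorted y t sorted) (∈ᵀ-insertT y t a∈t)
threeRows-after-seen {b = b} t c<b b<a (refl ∷ c⊆w) sorted a∈t =
  threeRows-after-stacked (insertT b t) c<b c⊆w (firstRow-sorted b t sorted) (stacked-inserted b t b<a a∈t)

decreasing⇒threeRows : ∀ {a b c w} t → c < b → b < a → (a ∷ b ∷ c ∷ []) ⊆ w →
                       AllPairs _≤_ (firstRow t) → ThreeRows (insertWord w t)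
decreasing⇒threeRows t c<b b<a (y ∷ʳ abc⊆w) sorted =
  decreasing⇒threeRows (insertT y t) c<b b<a abc⊆w (firstRow-sorted y t sorted)
decreasing⇒threeRows {a = a} t c<b b<a (refl ∷ bc⊆w) sorted =
  threeRows-after-seen (insertT a t) c<b b<a bc⊆w (firstRow-sorted a t sorted) (inserted-∈ᵀ a t)

length-filter-∪ : ∀ {a p q} {A : Set a} {P : Pred A p} {Q : Pred A q} (P? : Decidable P) (Q? : Decidable Q) →
                  (∀ x → P x ⊎ Q x) → ∀ xs →
                  length (filter P? xs) + length (filter Q? xs) ≡ length xs + length (filter (P? ∩? Q?) xs)
length-filter-∪ P? Q? cover []       = refl
length-filter-∪ P? Q? cover (x ∷ xs) with P? x | Q? x | length-filter-∪ P? Q? cover xs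
... | yes _ | yes _ | ih = cong suc (trans (+-suc _ _) (trans (cong suc ih) (sym (+-suc _ _))))
... | yes _ | no _  | ih = cong suc ih
... | no _  | yes _ | ih = trans (+-suc _ _) (cong suc ih)
... | no ¬p | no ¬q | _  with cover x
...   | inj₁ p = ⊥-elim (¬p p)
...   | inj₂ q = ⊥-elim (¬q q)

module _ {a r} {A : Set a} {_≺_ : Rel A r} (≺-irrefl : Irreflexive _≡_ _≺_) (≺-trans : Transitive _≺_) where

  private
    ∈-tail : ∀ {x xs zs} → All (x ≺_) zs → All (_∈ x ∷ xs) zs → All (_∈ xs) zs
    ∈-tail []           []               = []
    ∈-tail (x≺z ∷ _)    (here refl ∷ _)  = ⊥-elim (≺-irrefl refl x≺z)
    ∈-tail (_ ∷ x≺zs)   (there z∈ ∷ zs∈) = z∈ ∷ ∈-tail x≺zs zs∈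

  sorted-⊆ : ∀ {xs ys} → AllPairs _≺_ xs → AllPairs _≺_ ys → All (_∈ xs) ys → ys ⊆ xs
  sorted-⊆ {xs} {[]} _ _ _ = minimum xs
  sorted-⊆ (x≺xs ∷ sxs) (y≺ys ∷ sys) (here refl ∷ ys∈) = refl ∷ sorted-⊆ sxs sys (∈-tail y≺ys ys∈)
  sorted-⊆ {x ∷ _} (x≺xs ∷ sxs) (y≺ys ∷ sys) (there y∈ ∷ ys∈) =
    x ∷ʳ sorted-⊆ sxs (y≺ys ∷ sys) (y∈ ∷ ∈-tail (All.map (≺-trans (All.lookup x≺xs y∈)) y≺ys) ys∈)

allPairs-restrict : ∀ {a p r} {A : Set a} {P : Pred A p} {R : Rel A r} {xs} →
                    AllPairs (λ x y → P x → P y → R x y) xs → All P xs → AllPairs R xs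
allPairs-restrict []                 []         = []
allPairs-restrict (R-from-x ∷ pairs) (px ∷ pxs) =
  All.zipWith (λ (r , py) → r px py) (R-from-x , pxs) ∷ allPairs-restrict pairs pxs

indicator : ∀ {p} {P : Set p} → Dec P → ℕ
indicator d = if does d then 1 else 0

count : ∀ {n p} {P : Pred (Fin n) p} → Decidable P → ℕ
count P? = ∑ (indicator ∘ P?)

-- Both clauses are definitional: `toℕ (suc i) <? suc v` computes like `toℕ i <? v`.
count-positions-below : ∀ n v → v ≤ n → count {n} (λ i → toℕ i <? v) ≡ v
count-positions-below zero    zero    _         = refl
count-positions-below (suc n) zero    _         = count-positions-below n zero z≤n
count-positions-below (suc n) (suc v) (s≤s v≤n) = cong suc (count-positions-below n v v≤n)

indicator-mono-≤ : ∀ {p q} {P : Set p} {Q : Set q} → (P → Q) → (P? : Dec P) (Q? : Dec Q) →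
                   indicator P? ≤ indicator Q?
indicator-mono-≤ P⇒Q (yes p) (yes _) = ≤-refl
indicator-mono-≤ P⇒Q (yes p) (no ¬q) = ⊥-elim (¬q (P⇒Q p))
indicator-mono-≤ P⇒Q (no _)  _       = z≤n

indicator-< : ∀ {p q} {P : Set p} {Q : Set q} → ¬ P → Q → (P? : Dec P) (Q? : Dec Q) →
              indicator P? < indicator Q?
indicator-< ¬p q (yes p) _      = ⊥-elim (¬p p)
indicator-< ¬p q (no _) (yes _) = s≤s z≤n
indicator-< ¬p q (no _) (no ¬q) = ⊥-elim (¬q q)

count-mono-≤ : ∀ {n p q} {P : Pred (Fin n) p} {Q : Pred (Fin n) q} (P? : Decidable P) (Q? : Decidable Q) →
               (∀ i → P i → Q i) → count P? ≤ count Q?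
count-mono-≤ {zero}  P? Q? P⇒Q = z≤n
count-mono-≤ {suc n} P? Q? P⇒Q =
  +-mono-≤ (indicator-mono-≤ (P⇒Q zero) (P? zero) (Q? zero))
           (count-mono-≤ (P? ∘ suc) (Q? ∘ suc) (P⇒Q ∘ suc))

count-mono-< : ∀ {n p q} {P : Pred (Fin n) p} {Q : Pred (Fin n) q} (P? : Decidable P) (Q? : Decidable Q) →
               (∀ i → P i → Q i) → ∀ j → ¬ P j → Q j → count P? < count Q?
count-mono-< {suc n} P? Q? P⇒Q zero ¬Pj Qj =
  +-mono-<-≤ (indicator-< ¬Pj Qj (P? zero) (Q? zero))
             (count-mono-≤ (P? ∘ suc) (Q? ∘ suc) (P⇒Q ∘ suc))
count-mono-< {suc n} P? Q? P⇒Q (suc j) ¬Pj Qj =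
  +-mono-≤-< (indicator-mono-≤ (P⇒Q zero) (P? zero) (Q? zero))
             (count-mono-< (P? ∘ suc) (Q? ∘ suc) (P⇒Q ∘ suc) j ¬Pj Qj)

module _ {n : ℕ} (σ : Permutation′ n) where

  value : Fin n → ℕ
  value i = toℕ (σ ⟨$⟩ʳ i)

  value-injective : ∀ {i j} → value i ≡ value j → i ≡ j
  value-injective {i} {j} eq = begin
    i                   ≡⟨ inverseˡ σ ⟨
    σ ⟨$⟩ˡ (σ ⟨$⟩ʳ i)  ≡⟨ cong (σ ⟨$⟩ˡ_) (toℕ-injective eq) ⟩
    σ ⟨$⟩ˡ (σ ⟨$⟩ʳ j)  ≡⟨ inverseˡ σ ⟩
    j                   ∎
    where open ≡-Reasoning

  count-values-below : ∀ v → v ≤ n → count (λ i → value i <? v) ≡ v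
  count-values-below v v≤n =
    trans (sym (sum-permute (λ j → indicator (toℕ j <? v)) σ)) (count-positions-below n v v≤n)

  -- Counting: the σ(j) positions carrying a value below σ(j) cannot all lie
  -- among the j positions left of j, one of which (i) carries a larger value.
  smaller-value-to-the-right : ∀ {i j} → toℕ i < toℕ j → value j < value i → toℕ j ≤ value j →
                               ∃ λ k → toℕ j < toℕ k × value k < value j
  smaller-value-to-the-right {i} {j} i<j vj<vi j≤vj
    with any? (λ k → (toℕ j <? toℕ k) ×-dec (value k <? value j))
  ... | yes found = found
  ... | no ∄k   = ⊥-elim (<⇒≱ fewer-values j≤vj)
    where
    left-of-j : ∀ p → value p < value j → toℕ p < toℕ j
    left-of-j p vp<vj with <-cmp (toℕ p) (toℕ j)
    ... | tri< p<j _ _ = p<j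
    ... | tri≈ _ p≡j _ rewrite toℕ-injective p≡j = ⊥-elim (<-irrefl refl vp<vj)
    ... | tri> _ _ j<p = ⊥-elim (∄k (p , j<p , vp<vj))
    fewer-values : value j < toℕ j
    fewer-values = subst₂ _<_ (count-values-below (value j) (<⇒≤ (toℕ<n (σ ⟨$⟩ʳ j))))
                              (count-positions-below n (toℕ j) (<⇒≤ (toℕ<n j)))
                              (count-mono-< (λ p → value p <? value j) (λ p → toℕ p <? toℕ j)
                                            left-of-j i (<-asym vj<vi) i<j)

  larger-value-to-the-left : ∀ {i j} → toℕ i < toℕ j → value j < value i → value i ≤ toℕ i →
                             ∃ λ h → toℕ h < toℕ i × value i < value h
  larger-value-to-the-left {i} {j} i<j vj<vi vi≤i
    with any? (λ h → (toℕ h <? toℕ i) ×-dec (value i <? value h))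
  ... | yes found = found
  ... | no ∄h   = ⊥-elim (<⇒≱ (s<s⁻¹ fewer-positions) vi≤i)
    where
    value-at-most : ∀ p → toℕ p < suc (toℕ i) → value p < suc (value i)
    value-at-most p (s≤s p≤i) with <-cmp (toℕ p) (toℕ i)
    ... | tri< p<i _ _ = s≤s (≮⇒≥ (λ vi<vp → ∄h (p , p<i , vi<vp)))
    ... | tri≈ _ p≡i _ rewrite toℕ-injective p≡i = ≤-refl
    ... | tri> _ _ i<p = ⊥-elim (<⇒≱ i<p p≤i)
    fewer-positions : suc (toℕ i) < suc (value i)
    fewer-positions = subst₂ _<_ (count-positions-below n (suc (toℕ i)) (toℕ<n i))
                                 (count-values-below (suc (value i)) (toℕ<n (σ ⟨$⟩ʳ i)))
                                 (count-mono-< (λ p → toℕ p <? suc (toℕ i)) (λ p → value p <? suc (value i))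
                                               value-at-most j (λ { (s≤s j≤i) → <⇒≱ i<j j≤i }) (s≤s (<⇒≤ vj<vi)))

  Avoids321 : Set
  Avoids321 = ∀ {i j k} → toℕ i < toℕ j → toℕ j < toℕ k → value k < value j → value j < value i → ⊥

  noninversion⇒< : ∀ {i j} → toℕ i < toℕ j → ¬ value j < value i → value i < value j
  noninversion⇒< {i} {j} i<j ¬vj<vi with <-cmp (value i) (value j)
  ... | tri< vi<vj _ _ = vi<vj
  ... | tri≈ _ vi≡vj _ = ⊥-elim (<-irrefl (cong toℕ (value-injective vi≡vj)) i<j)
  ... | tri> _ _ vj<vi = ⊥-elim (¬vj<vi vj<vi)

  weak-excedance-increasing : Avoids321 → ∀ {i j} → toℕ i < toℕ j → toℕ j ≤ value j → value i < value j
  weak-excedance-increasing avoids i<j j≤vj = noninversion⇒< i<j λ vj<vi →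
    let (k , j<k , vk<vj) = smaller-value-to-the-right i<j vj<vi j≤vj in avoids i<j j<k vk<vj vj<vi

  weak-deficiency-increasing : Avoids321 → ∀ {i j} → toℕ i < toℕ j → value i ≤ toℕ i → value i < value j
  weak-deficiency-increasing avoids i<j vi≤i = noninversion⇒< i<j λ vj<vi →
    let (h , h<i , vi<vh) = larger-value-to-the-left i<j vj<vi vi≤i in avoids h<i i<j vj<vi vi<vh

  pattern⊆word : ∀ {i j k} → toℕ i < toℕ j → toℕ j < toℕ k → value i ∷ value j ∷ value k ∷ [] ⊆ word σ
  pattern⊆word {i} {j} {k} i<j j<k = map⁺ value
    (sorted-⊆ Fin.<-irrefl Fin.<-trans (AllPairs.tabulate⁺-< (λ i<j → i<j))
      ((i<j ∷ <-trans i<j j<k ∷ []) ∷ (j<k ∷ []) ∷ [] ∷ [])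
      (∈-allFin i ∷ ∈-allFin j ∷ ∈-allFin k ∷ []))

  twoRows⇒avoids321 : length (P σ) ≤ 2 → Avoids321
  twoRows⇒avoids321 rows≤2 i<j j<k vk<vj vj<vi =
    <⇒≱ (decreasing⇒threeRows [] vk<vj vj<vi (pattern⊆word i<j j<k) []) rows≤2

  increasing-on⇒≤firstRow : ∀ {p} {Q : Pred (Fin n) p} (Q? : Decidable Q) →
    (∀ {i j} → toℕ i < toℕ j → Q i → Q j → value i < value j) →
    length (filter Q? (allFin n)) ≤ length (firstRow (P σ))
  increasing-on⇒≤firstRow Q? increasing = begin
    length (filter Q? (allFin n))                 ≡⟨ length-map value (filter Q? (allFin n)) ⟨
    length (map value (filter Q? (allFin n))) ≤⟨ increasing⇒≤firstRow (map⁺ value (filter-⊆ Q? (allFin n))) sorted ⟩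
    length (firstRow (P σ))                       ∎
    where
    open ≤-Reasoning
    sorted : AllPairs _<_ (map value (filter Q? (allFin n)))
    sorted = AllPairs.map⁺ (allPairs-restrict (AllPairs.filter⁺ Q? (AllPairs.tabulate⁺-< increasing)) (all-filter Q? (allFin n)))

  weakExcedance? : Decidable (λ i → toℕ i ≤ value i)
  weakExcedance? i = toℕ i ≤? value i

  weakDeficiency? : Decidable (λ i → value i ≤ toℕ i)
  weakDeficiency? i = value i ≤? toℕ i

  weakExcedances≤firstRow : Avoids321 → length (filter weakExcedance? (allFin n)) ≤ length (firstRow (P σ))
  weakExcedances≤firstRow avoids =
    increasing-on⇒≤firstRow weakExcedance? (λ i<j _ j≤vj → weak-excedance-increasing avoids i<j j≤vj)

  weakDeficiencies≤firstRow : Avoids321 → length (filter weakDeficiency? (allFin n)) ≤ length (firstRow (P σ))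
  weakDeficiencies≤firstRow avoids =
    increasing-on⇒≤firstRow weakDeficiency? (λ i<j vi≤i _ → weak-deficiency-increasing avoids i<j vi≤i)

  weakExcedances+weakDeficiencies : length (filter weakExcedance? (allFin n)) + length (filter weakDeficiency? (allFin n))
                                    ≡ n + fixedPoints σ
  weakExcedances+weakDeficiencies = trans
    (length-filter-∪ weakExcedance? weakDeficiency? (λ i → ≤-total (toℕ i) (value i)) (allFin n))
    (cong₂ _+_ (length-tabulate (λ i → i)) (cong length (sym (filter-≐ _ _ fixed≐both (allFin n)))))
    where
    fixed≐both : (λ i → σ ⟨$⟩ʳ i ≡ i) ≐ (λ i → toℕ i ≤ value i × value i ≤ toℕ i)
    fixed≐both = (λ fixed → ≤-reflexive (cong toℕ (sym fixed)) , ≤-reflexive (cong toℕ fixed))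
               , (λ (i≤vi , vi≤i) → toℕ-injective (≤-antisym vi≤i i≤vi))

  sum-Γ-P : sum (Γ (P σ)) ≡ n
  sum-Γ-P = begin
    sum (Γ (P σ))          ≡⟨ sum-Γ-insertWord (word σ) [] ⟩
    length (word σ) + 0    ≡⟨ +-identityʳ _ ⟩
    length (word σ)        ≡⟨ length-map value (allFin n) ⟩
    length (allFin n)      ≡⟨ length-tabulate (λ i → i) ⟩
    n                      ∎
    where open ≡-Reasoning

length-firstRow : ∀ {t l ls} → Γ t ≡ l ∷ ls → length (firstRow t) ≡ l
length-firstRow {_ ∷ _} refl = refl

lemma5p5 : ∀ (n : ℕ) (σ : Permutation′ n) (λ₁ λ₂ r : ℕ) →
    Γ (P σ) ≡ λ₁ ∷ λ₂ ∷ [] →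
    fixedPoints σ ≡ r →
    λ₂ + r ≤ λ₁
lemma5p5 n σ λ₁ λ₂ r shape refl = +-cancelˡ-≤ λ₁ (λ₂ + r) λ₁ (begin
  λ₁ + (λ₂ + r)  ≡⟨ +-assoc λ₁ λ₂ r ⟨
  λ₁ + λ₂ + r    ≡⟨ cong (_+ r) size ⟩
  n + r          ≡⟨ weakExcedances+weakDeficiencies σ ⟨
  _              ≤⟨ +-mono-≤ (bounded (weakExcedances≤firstRow σ avoids)) (bounded (weakDeficiencies≤firstRow σ avoids)) ⟩
  λ₁ + λ₁        ∎)
  where
  open ≤-Reasoning
  avoids : Avoids321 σ
  avoids = twoRows⇒avoids321 σ (≤-reflexive (trans (sym (length-map length (P σ))) (cong length shape)))
  bounded : ∀ {m} → m ≤ length (firstRow (P σ)) → m ≤ λ₁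
  bounded m≤ = ≤-trans m≤ (≤-reflexive (length-firstRow shape))
  size : λ₁ + λ₂ ≡ n
  size = trans (cong (λ₁ +_) (sym (+-identityʳ λ₂))) (trans (cong sum (sym shape)) (sum-Γ-P σ))
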